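{- Let $2 \leq k \leq n$, and let $\mathcal{H}$ be a connected $k$-uniform hypergraph with $n$ vertices. Then \[ HM_1(\mathcal{H}) \leq \binom{n}{k} k^2 \binom{n-1}{k-1}^2, \qquad HM_2(\mathcal{H}) \leq \binom{n}{k} \binom{n-1}{k-1}^{2k}. \] Equality holds if and only if $\mathcal{H} = \mathcal{K}_n^{(k)}$.
   Context: A hypergraph $\mathcal{H}$ consists of a non-empty finite vertex set $V(\mathcal{H})$ and a set $E(\mathcal{H})$ of hyperedges, each a subset of $V(\mathcal{H})$ with at least two vertices. The degree $d_{\mathcal{H}}(v)$ is the number of hyperedges containing $v$. $\mathcal{H}$ is $k$-uniform if every hyperedge has exactly $k$ vertices. A path is a sequence $v_0, e_1, v_1, \ldots, e_t, v_t$ of distinct vertices and distinct hyperedges with $\{v_{i-1}, v_i\} \subseteq e_i$; $\mathcal{H}$ is connected if any two vertices are joined by a path. $HM_1(\mathcal{H}) = \sum_{e \in E(\mathcal{H})} \left[ \sum_{v \in e} d_{\mathcal{H}}(v) \right]^2$ and $HM_2(\mathcal{H}) = \sum_{e \in E(\mathcal{H})} \left[ \prod_{v \in e} d_{\mathcal{H}}(v) \right]^2$. $\mathcal{K}_n^{(k)}$ denotes the complete $k$-uniform hypergraph on the $n$ vertices, whose hyperedges are all $k$-element subsets. -}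

module Defs where

open import Data.Nat using (ℕ; zero; suc; _+_; _*_; _∸_; _^_; _≤_)
open import Data.Bool using (if_then_else_)
open import Data.Fin using (Fin; zero; suc; inject₁)
open import Data.Fin.Subset using (Subset; _∈_; ∣_∣)
open import Data.Fin.Subset.Properties using (_∈?_)
open import Data.Nat.ListAction using (sum; product)
open import Data.List using (List; map; allFin; length; filter)
open import Data.List.Relation.Unary.Unique.Propositional using (Unique)
import Data.List.Membership.Propositional as LM
open import Data.Vec using (Vec; lookup)
open import Data.Product using (Σ; _×_)
open import Relation.Binary.PropositionalEquality using (_≡_)
open import Relation.Nullary.Decidable using (does)
open import Function.Bundles using (_⇔_)

record Hypergraph (n : ℕ) : Set where
  field
    edges    : List (Subset n)
    distinct : Unique edges
    edgeSize : ∀ {e} → e LM.∈ edges → 2 ≤ ∣ e ∣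
open Hypergraph public

module _ {n : ℕ} (H : Hypergraph n) where

  _∈E : Subset n → Set
  e ∈E = e LM.∈ edges H

  Uniform : ℕ → Set
  Uniform k = ∀ {e} → e ∈E → ∣ e ∣ ≡ k

  degree : Fin n → ℕ
  degree v = length (filter (λ e → v ∈? e) (edges H))

  record Path (u w : Fin n) : Set where
    field
      len       : ℕ
      verts     : Vec (Fin n) (suc len)
      hedges    : Vec (Subset n) len
      start     : lookup verts zero ≡ u
      finish    : lookup verts (Data.Fin.fromℕ len) ≡ w
      inE       : ∀ i → lookup hedges i ∈E
      leftIn    : ∀ i → lookup verts (inject₁ i) ∈ lookup hedges i
      rightIn   : ∀ i → lookup verts (suc i) ∈ lookup hedges i
      vertsDist : ∀ i j → lookup verts i ≡ lookup verts j → i ≡ j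
      edgesDist : ∀ i j → lookup hedges i ≡ lookup hedges j → i ≡ j

  Connected : Set
  Connected = ∀ u w → Path u w

  degSum : Subset n → ℕ
  degSum e = sum (map (λ v → if does (v ∈? e) then degree v else 0) (allFin n))

  degProd : Subset n → ℕ
  degProd e = product (map (λ v → if does (v ∈? e) then degree v else 1) (allFin n))

  HM₁ : ℕ
  HM₁ = sum (map (λ e → degSum e ^ 2) (edges H))

  HM₂ : ℕ
  HM₂ = sum (map (λ e → degProd e ^ 2) (edges H))

  IsComplete : ℕ → Set
  IsComplete k = ∀ (e : Subset n) → (e ∈E ⇔ (∣ e ∣ ≡ k))

{-# OPTIONS --safe #-}
-- Every hyperedge of a k-uniform hypergraph on n vertices is one of the
-- C(n,k) k-subsets, and every vertex v lies in at most C(n-1,k-1) of them,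
-- since inserting v is a bijection from the (k-1)-subsets of the other
-- n-1 vertices onto the k-subsets containing v. Hence each of the at most
-- C(n,k) summands of HM₁ is at most (k C(n-1,k-1))², and each summand of
-- HM₂ at most C(n-1,k-1)^(2k). Equality forces C(n,k) summands, i.e.
-- all k-subsets are hyperedges; conversely in K_n^(k) every degree is
-- exactly C(n-1,k-1).
module Submission where

open import Defs
open import Data.Bool using (Bool; if_then_else_)
open import Data.Bool.Properties using () renaming (_≟_ to _≟ᴮ_)
open import Data.Empty using (⊥)
open import Data.Fin using (Fin; zero; suc)
open import Data.Fin.Subset using (Subset; ∣_∣; inside; outside) renaming (_∈_ to _∈ˢ_)
open import Data.Fin.Subset.Properties using (_∈?_)
open import Data.List using (List; []; _∷_; map; _++_; length; filter; tabulate)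
open import Data.List.Fresh as Fresh using (fromList)
open import Data.List.Fresh.Relation.Unary.Any as Any# using ()
import Data.List.Fresh.Membership.Setoid as Membership#
import Data.List.Fresh.Membership.Setoid.Properties as Membership#ₚ
open import Data.List.Membership.Propositional using (_∈_; _∉_)
open import Data.List.Membership.Propositional.Properties
  using (∈-map⁺; ∈-map⁻; ∈-++⁺ˡ; ∈-++⁺ʳ; ∈-++⁻; ∈-filter⁺; ∈-filter⁻)
import Data.List.Membership.DecPropositional as DecMembership
open import Data.List.Properties using (length-map; length-++; map-tabulate)
open import Data.List.Relation.Binary.Subset.Propositional using (_⊆_)
open import Data.List.Relation.Unary.Any using (here; there)
open import Data.List.Relation.Unary.All using ([])
open import Data.List.Relation.Unary.AllPairs using ([]; _∷_)
open import Data.List.Relation.Unary.Unique.Propositional using (Unique)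
import Data.List.Relation.Unary.Unique.Propositional.Properties as Unique
open import Data.Nat using (ℕ; zero; suc; _+_; _*_; _^_; _∸_; _≤_; _<_; z≤n; s≤s; NonZero; >-nonZero)
open import Data.Nat.Combinatorics using (_C_; nCk+nC[k+1]≡[n+1]C[k+1])
open import Data.Nat.ListAction using (sum; product)
open import Data.Nat.Properties
open import Data.Nat.Solver using (module +-*-Solver)
open import Data.Product using (_×_; _,_)
open import Data.Sum using (inj₁; inj₂)
open import Data.Vec using ([]; _∷_; insertAt; removeAt)
open import Data.Vec.Properties using (≡-dec; ∷-injectiveʳ; insertAt-lookup; removeAt-insertAt; insertAt-removeAt; []=⇒lookup; lookup⇒[]=)
open import Function using (_∘_; id)
open import Function.Bundles using (_⇔_; mk⇔; Equivalence)
open import Relation.Binary.Definitions using (DecidableEquality)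
open import Relation.Binary.PropositionalEquality
  using (_≡_; refl; sym; trans; cong; cong₂; subst; subst₂; setoid; module ≡-Reasoning)
open import Relation.Nullary using (yes; no; does; contradiction)

private
  variable
    A : Set

module _ {A : Set} where

  open Membership# (setoid A) using () renaming (_∈_ to _∈#_)

  length-fromList : ∀ {xs : List A} (u : Unique xs) → Fresh.length (fromList u) ≡ length xs
  length-fromList []      = refl
  length-fromList (_ ∷ u) = cong suc (length-fromList u)

  ∈-fromList⁺ : ∀ {x} {xs : List A} {u : Unique xs} → x ∈ xs → x ∈# fromList u
  ∈-fromList⁺ {u = _ ∷ _} (here x≡y) = Any#.here x≡y
  ∈-fromList⁺ {u = _ ∷ _} (there p)  = Any#.there (∈-fromList⁺ p)

  ∈-fromList⁻ : ∀ {x} {xs : List A} {u : Unique xs} → x ∈# fromList u → x ∈ xs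
  ∈-fromList⁻ {u = _ ∷ _} (Any#.here x≡y) = here x≡y
  ∈-fromList⁻ {u = _ ∷ _} (Any#.there p)  = there (∈-fromList⁻ p)

  length-≤-⊆ : ∀ {xs ys : List A} → Unique xs → Unique ys → xs ⊆ ys → length xs ≤ length ys
  length-≤-⊆ uxs uys xs⊆ys =
    subst₂ _≤_ (length-fromList uxs) (length-fromList uys)
      (Membership#ₚ.injection (setoid A) id
        (λ x∈xs → ∈-fromList⁺ (xs⊆ys (∈-fromList⁻ x∈xs))))

  length-<-⊆ : ∀ {xs ys : List A} {y} → Unique xs → Unique ys → xs ⊆ ys →
               y ∈ ys → y ∉ xs → length xs < length ys
  length-<-⊆ {y = y} uxs uys xs⊆ys y∈ys y∉xs =
    subst₂ _<_ (length-fromList uxs) (length-fromList uys)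
      (Membership#ₚ.strict-injection (setoid A) id
        (λ x∈xs → ∈-fromList⁺ (xs⊆ys (∈-fromList⁻ x∈xs)))
        (y , ∈-fromList⁺ y∈ys , λ y∈#xs → y∉xs (∈-fromList⁻ y∈#xs)))

sum-map-≤ : ∀ {xs : List A} {f : A → ℕ} {b} → (∀ {x} → x ∈ xs → f x ≤ b) →
            sum (map f xs) ≤ length xs * b
sum-map-≤ {xs = []}    f≤b = z≤n
sum-map-≤ {xs = _ ∷ _} f≤b = +-mono-≤ (f≤b (here refl)) (sum-map-≤ (f≤b ∘ there))

sum-map-≡ : ∀ {xs : List A} {f : A → ℕ} {b} → (∀ {x} → x ∈ xs → f x ≡ b) →
            sum (map f xs) ≡ length xs * b
sum-map-≡ {xs = []}    f≡b = refl
sum-map-≡ {xs = _ ∷ _} f≡b = cong₂ _+_ (f≡b (here refl)) (sum-map-≡ (f≡b ∘ there))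

-- A missing element of ys costs at least one full summand b.
sum-map-≡⇒⊇ : DecidableEquality A → ∀ {xs ys : List A} {f : A → ℕ} {b} →
              Unique xs → Unique ys → xs ⊆ ys → 0 < b → (∀ {x} → x ∈ xs → f x ≤ b) →
              sum (map f xs) ≡ length ys * b → ys ⊆ xs
sum-map-≡⇒⊇ _≟_ {xs} {ys} {f} {b} uxs uys xs⊆ys 0<b f≤b sum≡ {y} y∈ys with DecMembership._∈?_ _≟_ y xs
... | yes y∈xs = y∈xs
... | no  y∉xs = contradiction sum≡ (<⇒≢ (begin-strict
  sum (map f xs) ≤⟨ sum-map-≤ f≤b ⟩
  length xs * b  <⟨ *-monoˡ-< b {{>-nonZero 0<b}} (length-<-⊆ uxs uys xs⊆ys y∈ys y∉xs) ⟩
  length ys * b  ∎))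
  where open ≤-Reasoning

subsetsOfSize : (n k : ℕ) → List (Subset n)
subsetsOfSize zero    zero    = [] ∷ []
subsetsOfSize zero    (suc k) = []
subsetsOfSize (suc n) zero    = map (outside ∷_) (subsetsOfSize n zero)
subsetsOfSize (suc n) (suc k) =
  map (outside ∷_) (subsetsOfSize n (suc k)) ++ map (inside ∷_) (subsetsOfSize n k)

length-subsetsOfSize : ∀ n k → length (subsetsOfSize n k) ≡ n C k
length-subsetsOfSize zero    zero    = refl
length-subsetsOfSize zero    (suc k) = refl
length-subsetsOfSize (suc n) zero    =
  trans (length-map _ (subsetsOfSize n zero)) (length-subsetsOfSize n zero)
length-subsetsOfSize (suc n) (suc k) = begin
  length (map (outside ∷_) (subsetsOfSize n (suc k)) ++ map (inside ∷_) (subsetsOfSize n k))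
    ≡⟨ length-++ (map (outside ∷_) (subsetsOfSize n (suc k))) ⟩
  length (map (outside ∷_) (subsetsOfSize n (suc k))) + length (map (inside ∷_) (subsetsOfSize n k))
    ≡⟨ cong₂ _+_ (length-map _ (subsetsOfSize n (suc k))) (length-map _ (subsetsOfSize n k)) ⟩
  length (subsetsOfSize n (suc k)) + length (subsetsOfSize n k)
    ≡⟨ cong₂ _+_ (length-subsetsOfSize n (suc k)) (length-subsetsOfSize n k) ⟩
  n C suc k + n C k
    ≡⟨ +-comm (n C suc k) (n C k) ⟩
  n C k + n C suc k
    ≡⟨ nCk+nC[k+1]≡[n+1]C[k+1] n k ⟩
  suc n C suc k ∎
  where open ≡-Reasoning

∈-subsetsOfSize⁺ : ∀ {n k} {p : Subset n} → ∣ p ∣ ≡ k → p ∈ subsetsOfSize n k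
∈-subsetsOfSize⁺ {zero}  {zero}  {[]}           refl  = here refl
∈-subsetsOfSize⁺ {suc n} {zero}  {outside ∷ p}  ∣p∣≡k = ∈-map⁺ _ (∈-subsetsOfSize⁺ ∣p∣≡k)
∈-subsetsOfSize⁺ {suc n} {suc k} {outside ∷ p}  ∣p∣≡k = ∈-++⁺ˡ (∈-map⁺ (outside ∷_) (∈-subsetsOfSize⁺ ∣p∣≡k))
∈-subsetsOfSize⁺ {suc n} {suc k} {inside ∷ p}   ∣p∣≡k =
  ∈-++⁺ʳ (map (outside ∷_) (subsetsOfSize n (suc k))) (∈-map⁺ _ (∈-subsetsOfSize⁺ (suc-injective ∣p∣≡k)))

∈-subsetsOfSize⁻ : ∀ {n k} {p : Subset n} → p ∈ subsetsOfSize n k → ∣ p ∣ ≡ k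
∈-subsetsOfSize⁻ {zero}  {zero}  (here refl) = refl
∈-subsetsOfSize⁻ {suc n} {zero}  p∈ with ∈-map⁻ _ p∈
... | _ , q∈ , refl = ∈-subsetsOfSize⁻ q∈
∈-subsetsOfSize⁻ {suc n} {suc k} p∈ with ∈-++⁻ (map (outside ∷_) (subsetsOfSize n (suc k))) p∈
... | inj₁ p∈ˡ with ∈-map⁻ _ p∈ˡ
...   | _ , q∈ , refl = ∈-subsetsOfSize⁻ q∈
∈-subsetsOfSize⁻ {suc n} {suc k} p∈ | inj₂ p∈ʳ with ∈-map⁻ _ p∈ʳ
...   | _ , q∈ , refl = cong suc (∈-subsetsOfSize⁻ q∈)

unique-subsetsOfSize : ∀ n k → Unique (subsetsOfSize n k)
unique-subsetsOfSize zero    zero    = [] ∷ []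
unique-subsetsOfSize zero    (suc k) = []
unique-subsetsOfSize (suc n) zero    = Unique.map⁺ ∷-injectiveʳ (unique-subsetsOfSize n zero)
unique-subsetsOfSize (suc n) (suc k) =
  Unique.++⁺ (Unique.map⁺ ∷-injectiveʳ (unique-subsetsOfSize n (suc k)))
             (Unique.map⁺ ∷-injectiveʳ (unique-subsetsOfSize n k))
             disjoint
  where
  disjoint : ∀ {p} → p ∈ map (outside ∷_) (subsetsOfSize n (suc k)) × p ∈ map (inside ∷_) (subsetsOfSize n k) → ⊥
  disjoint (p∈ˡ , p∈ʳ) with ∈-map⁻ _ p∈ˡ | ∈-map⁻ _ p∈ʳ
  ... | _ , _ , refl | _ , _ , ()

∣insertAt-inside∣ : ∀ {m} (p : Subset m) (v : Fin (suc m)) → ∣ insertAt p v inside ∣ ≡ suc ∣ p ∣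
∣insertAt-inside∣ p             zero    = refl
∣insertAt-inside∣ (inside ∷ p)  (suc v) = cong suc (∣insertAt-inside∣ p v)
∣insertAt-inside∣ (outside ∷ p) (suc v) = ∣insertAt-inside∣ p v

∈-insertAt-inside : ∀ {m} (p : Subset m) (v : Fin (suc m)) → v ∈ˢ insertAt p v inside
∈-insertAt-inside p v = lookup⇒[]= v _ (insertAt-lookup p v inside)

insertAt-removeAt-inside : ∀ {m} {q : Subset (suc m)} {v} → v ∈ˢ q → insertAt (removeAt q v) v inside ≡ q
insertAt-removeAt-inside {q = q} {v} v∈q =
  subst (λ b → insertAt (removeAt q v) v b ≡ q) ([]=⇒lookup v∈q) (insertAt-removeAt q v)

insertAt-injective : ∀ {m} {p q : Subset m} (v : Fin (suc m)) (b : Bool) →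
                     insertAt p v b ≡ insertAt q v b → p ≡ q
insertAt-injective {p = p} {q} v b eq = begin
  p                           ≡⟨ removeAt-insertAt p v b ⟨
  removeAt (insertAt p v b) v ≡⟨ cong (λ r → removeAt r v) eq ⟩
  removeAt (insertAt q v b) v ≡⟨ removeAt-insertAt q v b ⟩
  q                           ∎
  where open ≡-Reasoning

subsetsOfSizeContaining : ∀ {m} → Fin (suc m) → ℕ → List (Subset (suc m))
subsetsOfSizeContaining     v zero    = []
subsetsOfSizeContaining {m} v (suc j) = map (λ p → insertAt p v inside) (subsetsOfSize m j)

module _ {m} (v : Fin (suc m)) (j : ℕ) where

  length-subsetsOfSizeContaining : length (subsetsOfSizeContaining v (suc j)) ≡ m C j
  length-subsetsOfSizeContaining = trans (length-map _ (subsetsOfSize m j)) (length-subsetsOfSize m j)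

  unique-subsetsOfSizeContaining : Unique (subsetsOfSizeContaining v (suc j))
  unique-subsetsOfSizeContaining = Unique.map⁺ (insertAt-injective v inside) (unique-subsetsOfSize m j)

  ∈-subsetsOfSizeContaining⁺ : ∀ {q} → v ∈ˢ q → ∣ q ∣ ≡ suc j → q ∈ subsetsOfSizeContaining v (suc j)
  ∈-subsetsOfSizeContaining⁺ {q} v∈q ∣q∣≡1+j =
    subst (_∈ subsetsOfSizeContaining v (suc j)) (insertAt-removeAt-inside v∈q)
      (∈-map⁺ (λ p → insertAt p v inside) (∈-subsetsOfSize⁺ (suc-injective (begin
        suc ∣ removeAt q v ∣                 ≡⟨ ∣insertAt-inside∣ (removeAt q v) v ⟨
        ∣ insertAt (removeAt q v) v inside ∣ ≡⟨ cong ∣_∣ (insertAt-removeAt-inside v∈q) ⟩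
        ∣ q ∣                                ≡⟨ ∣q∣≡1+j ⟩
        suc j                                ∎))))
    where open ≡-Reasoning

  ∈-subsetsOfSizeContaining⁻ : ∀ {q} → q ∈ subsetsOfSizeContaining v (suc j) → v ∈ˢ q × ∣ q ∣ ≡ suc j
  ∈-subsetsOfSizeContaining⁻ q∈ with ∈-map⁻ _ q∈
  ... | p , p∈ , refl = ∈-insertAt-inside p v , trans (∣insertAt-inside∣ p v) (cong suc (∈-subsetsOfSize⁻ p∈))

sum-indicator-≤ : ∀ {n} (e : Subset n) {g : Fin n → ℕ} {d} → (∀ v → g v ≤ d) →
                  sum (tabulate (λ v → if does (v ∈? e) then g v else 0)) ≤ ∣ e ∣ * d
sum-indicator-≤ []            g≤d = z≤n
sum-indicator-≤ (inside ∷ e)  g≤d = +-mono-≤ (g≤d zero) (sum-indicator-≤ e (g≤d ∘ suc))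
sum-indicator-≤ (outside ∷ e) g≤d = sum-indicator-≤ e (g≤d ∘ suc)

sum-indicator-≡ : ∀ {n} (e : Subset n) {g : Fin n → ℕ} {d} → (∀ v → g v ≡ d) →
                  sum (tabulate (λ v → if does (v ∈? e) then g v else 0)) ≡ ∣ e ∣ * d
sum-indicator-≡ []            g≡d = refl
sum-indicator-≡ (inside ∷ e)  g≡d = cong₂ _+_ (g≡d zero) (sum-indicator-≡ e (g≡d ∘ suc))
sum-indicator-≡ (outside ∷ e) g≡d = sum-indicator-≡ e (g≡d ∘ suc)

product-indicator-≤ : ∀ {n} (e : Subset n) {g : Fin n → ℕ} {d} → (∀ v → g v ≤ d) →
                      product (tabulate (λ v → if does (v ∈? e) then g v else 1)) ≤ d ^ ∣ e ∣
product-indicator-≤ []            g≤d = ≤-refl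
product-indicator-≤ (inside ∷ e)  g≤d = *-mono-≤ (g≤d zero) (product-indicator-≤ e (g≤d ∘ suc))
product-indicator-≤ (outside ∷ e) g≤d = subst (_≤ _) (sym (+-identityʳ _)) (product-indicator-≤ e (g≤d ∘ suc))

product-indicator-≡ : ∀ {n} (e : Subset n) {g : Fin n → ℕ} {d} → (∀ v → g v ≡ d) →
                      product (tabulate (λ v → if does (v ∈? e) then g v else 1)) ≡ d ^ ∣ e ∣
product-indicator-≡ []            g≡d = refl
product-indicator-≡ (inside ∷ e)  g≡d = cong₂ _*_ (g≡d zero) (product-indicator-≡ e (g≡d ∘ suc))
product-indicator-≡ (outside ∷ e) g≡d = trans (+-identityʳ _) (product-indicator-≡ e (g≡d ∘ suc))

module _ {n} (H : Hypergraph n) where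

  private
    degSum-tabulate : ∀ e → degSum H e ≡ sum (tabulate (λ v → if does (v ∈? e) then degree H v else 0))
    degSum-tabulate e = cong sum (map-tabulate {n = n} (λ v → v) _)

    degProd-tabulate : ∀ e → degProd H e ≡ product (tabulate (λ v → if does (v ∈? e) then degree H v else 1))
    degProd-tabulate e = cong product (map-tabulate {n = n} (λ v → v) _)

  degSum-≤ : ∀ {d} → (∀ v → degree H v ≤ d) → ∀ e → degSum H e ≤ ∣ e ∣ * d
  degSum-≤ deg≤d e = subst (_≤ _) (sym (degSum-tabulate e)) (sum-indicator-≤ e deg≤d)

  degSum-≡ : ∀ {d} → (∀ v → degree H v ≡ d) → ∀ e → degSum H e ≡ ∣ e ∣ * d
  degSum-≡ deg≡d e = trans (degSum-tabulate e) (sum-indicator-≡ e deg≡d)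

  degProd-≤ : ∀ {d} → (∀ v → degree H v ≤ d) → ∀ e → degProd H e ≤ d ^ ∣ e ∣
  degProd-≤ deg≤d e = subst (_≤ _) (sym (degProd-tabulate e)) (product-indicator-≤ e deg≤d)

  degProd-≡ : ∀ {d} → (∀ v → degree H v ≡ d) → ∀ e → degProd H e ≡ d ^ ∣ e ∣
  degProd-≡ deg≡d e = trans (degProd-tabulate e) (product-indicator-≡ e deg≡d)

  module _ {k : ℕ} where

    ExtremalBound : ℕ → ℕ → Set
    ExtremalBound s t = s ≤ t × (s ≡ t ⇔ IsComplete H k)

    complete⇒uniform : IsComplete H k → Uniform H k
    complete⇒uniform complete {e} = Equivalence.to (complete e)

    edges⊆subsetsOfSize : Uniform H k → edges H ⊆ subsetsOfSize n k
    edges⊆subsetsOfSize uniform e∈E = ∈-subsetsOfSize⁺ (uniform e∈E)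

    subsetsOfSize⊆edges : IsComplete H k → subsetsOfSize n k ⊆ edges H
    subsetsOfSize⊆edges complete {e} e∈ = Equivalence.from (complete e) (∈-subsetsOfSize⁻ e∈)

    subsetsOfSize⊆edges⇒complete : Uniform H k → subsetsOfSize n k ⊆ edges H → IsComplete H k
    subsetsOfSize⊆edges⇒complete uniform ⊆E e = mk⇔ uniform (⊆E ∘ ∈-subsetsOfSize⁺)

    edgeCount-≤ : Uniform H k → length (edges H) ≤ n C k
    edgeCount-≤ uniform = subst (_ ≤_) (length-subsetsOfSize n k)
      (length-≤-⊆ (distinct H) (unique-subsetsOfSize n k) (edges⊆subsetsOfSize uniform))

    edgeCount-complete : IsComplete H k → length (edges H) ≡ n C k
    edgeCount-complete complete = ≤-antisym (edgeCount-≤ (complete⇒uniform complete))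
      (subst (_≤ _) (length-subsetsOfSize n k)
        (length-≤-⊆ (unique-subsetsOfSize n k) (distinct H) (subsetsOfSize⊆edges complete)))

    edgeSum-extremal : ∀ (f : Subset n → ℕ) {b} → Uniform H k → 0 < b →
                       (∀ {e} → e ∈ edges H → f e ≤ b) → (IsComplete H k → ∀ {e} → e ∈ edges H → f e ≡ b) →
                       ExtremalBound (sum (map f (edges H))) ((n C k) * b)
    edgeSum-extremal f {b} uniform 0<b f≤b complete⇒f≡b = sum≤ , mk⇔ sum≡⇒complete complete⇒sum≡
      where
      sum≤ : sum (map f (edges H)) ≤ (n C k) * b
      sum≤ = ≤-trans (sum-map-≤ f≤b) (*-monoˡ-≤ b (edgeCount-≤ uniform))

      sum≡⇒complete : sum (map f (edges H)) ≡ (n C k) * b → IsComplete H k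
      sum≡⇒complete sum≡ = subsetsOfSize⊆edges⇒complete uniform
        (sum-map-≡⇒⊇ (≡-dec _≟ᴮ_) (distinct H) (unique-subsetsOfSize n k) (edges⊆subsetsOfSize uniform)
          0<b f≤b (trans sum≡ (cong (_* b) (sym (length-subsetsOfSize n k)))))

      complete⇒sum≡ : IsComplete H k → sum (map f (edges H)) ≡ (n C k) * b
      complete⇒sum≡ complete =
        trans (sum-map-≡ (complete⇒f≡b complete)) (cong (_* b) (edgeCount-complete complete))

nCk>0 : ∀ {n k} → k ≤ n → 0 < n C k
nCk>0 {n}     {zero}  _         = s≤s z≤n
nCk>0 {suc n} {suc k} (s≤s k≤n) =
  subst (0 <_) (nCk+nC[k+1]≡[n+1]C[k+1] n k) (≤-trans (nCk>0 k≤n) (m≤m+n _ _))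

module _ {m} (H : Hypergraph (suc m)) {j : ℕ} where

  degree-≤ : Uniform H (suc j) → ∀ v → degree H v ≤ m C j
  degree-≤ uniform v = subst (_ ≤_) (length-subsetsOfSizeContaining v j)
    (length-≤-⊆ (Unique.filter⁺ (v ∈?_) (distinct H)) (unique-subsetsOfSizeContaining v j) edges∋v⊆)
    where
    edges∋v⊆ : filter (v ∈?_) (edges H) ⊆ subsetsOfSizeContaining v (suc j)
    edges∋v⊆ e∈ with ∈-filter⁻ (v ∈?_) {xs = edges H} e∈
    ... | e∈E , v∈e = ∈-subsetsOfSizeContaining⁺ v j v∈e (uniform e∈E)

  degree-complete : IsComplete H (suc j) → ∀ v → degree H v ≡ m C j
  degree-complete complete v = ≤-antisym (degree-≤ (complete⇒uniform H complete) v)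
    (subst (_≤ _) (length-subsetsOfSizeContaining v j)
      (length-≤-⊆ (unique-subsetsOfSizeContaining v j) (Unique.filter⁺ (v ∈?_) (distinct H)) ⊆edges∋v))
    where
    ⊆edges∋v : subsetsOfSizeContaining v (suc j) ⊆ filter (v ∈?_) (edges H)
    ⊆edges∋v e∈ with ∈-subsetsOfSizeContaining⁻ v j e∈
    ... | v∈e , ∣e∣≡k = ∈-filter⁺ (v ∈?_) (Equivalence.from (complete _) ∣e∣≡k) v∈e

  degSum-edge-≤ : Uniform H (suc j) → ∀ {e} → e ∈ edges H → degSum H e ≤ suc j * (m C j)
  degSum-edge-≤ uniform {e} e∈E =
    subst (λ s → degSum H e ≤ s * (m C j)) (uniform e∈E) (degSum-≤ H (degree-≤ uniform) e)

  degSum-edge-complete : IsComplete H (suc j) → ∀ {e} → e ∈ edges H → degSum H e ≡ suc j * (m C j)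
  degSum-edge-complete complete {e} e∈E =
    trans (degSum-≡ H (degree-complete complete) e) (cong (_* (m C j)) (complete⇒uniform H complete e∈E))

  degProd-edge-≤ : Uniform H (suc j) → ∀ {e} → e ∈ edges H → degProd H e ≤ (m C j) ^ suc j
  degProd-edge-≤ uniform {e} e∈E =
    subst (λ s → degProd H e ≤ (m C j) ^ s) (uniform e∈E) (degProd-≤ H (degree-≤ uniform) e)

  degProd-edge-complete : IsComplete H (suc j) → ∀ {e} → e ∈ edges H → degProd H e ≡ (m C j) ^ suc j
  degProd-edge-complete complete {e} e∈E =
    trans (degProd-≡ H (degree-complete complete) e) (cong ((m C j) ^_) (complete⇒uniform H complete e∈E))

  module _ (j≤m : j ≤ m) (uniform : Uniform H (suc j)) where

    private instance
      mCj≢0 : NonZero (m C j)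
      mCj≢0 = >-nonZero (nCk>0 j≤m)

    HM₁-extremal : ExtremalBound H (HM₁ H) ((suc m C suc j) * (suc j * (m C j)) ^ 2)
    HM₁-extremal = edgeSum-extremal H _ uniform (m^n>0 (suc j * (m C j)) {{m*n≢0 (suc j) (m C j)}} 2)
      (λ e∈E → ^-monoˡ-≤ 2 (degSum-edge-≤ uniform e∈E))
      (λ complete e∈E → cong (_^ 2) (degSum-edge-complete complete e∈E))

    HM₂-extremal : ExtremalBound H (HM₂ H) ((suc m C suc j) * ((m C j) ^ suc j) ^ 2)
    HM₂-extremal = edgeSum-extremal H _ uniform (m^n>0 ((m C j) ^ suc j) {{m^n≢0 (m C j) (suc j)}} 2)
      (λ e∈E → ^-monoˡ-≤ 2 (degProd-edge-≤ uniform e∈E))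
      (λ complete e∈E → cong (_^ 2) (degProd-edge-complete complete e∈E))

c*[a*b]²≡c*a²*b² : ∀ c a b → c * (a * b) ^ 2 ≡ c * a ^ 2 * b ^ 2
c*[a*b]²≡c*a²*b² = solve 3 (λ c a b → c :* (a :* b) :^ 2 := c :* a :^ 2 :* b :^ 2) refl
  where open +-*-Solver

[a^k]²≡a^[2*k] : ∀ a k → (a ^ k) ^ 2 ≡ a ^ (2 * k)
[a^k]²≡a^[2*k] a k = trans (^-*-assoc a k 2) (cong (a ^_) (*-comm k 2))

mainTheorem4 : (n k : ℕ) → 2 ≤ k → k ≤ n → (H : Hypergraph n) → Connected H → Uniform H k →
    (HM₁ H ≤ (n C k) * k ^ 2 * ((n ∸ 1) C (k ∸ 1)) ^ 2)
    × (HM₂ H ≤ (n C k) * ((n ∸ 1) C (k ∸ 1)) ^ (2 * k))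
    × (HM₁ H ≡ (n C k) * k ^ 2 * ((n ∸ 1) C (k ∸ 1)) ^ 2 ⇔ IsComplete H k)
    × (HM₂ H ≡ (n C k) * ((n ∸ 1) C (k ∸ 1)) ^ (2 * k) ⇔ IsComplete H k)
mainTheorem4 n       zero    ()
mainTheorem4 zero    (suc j) _ ()
mainTheorem4 (suc m) (suc j) _ (s≤s j≤m) H _ uniform =
  let HM₁≤ , HM₁≡⇔ = subst (ExtremalBound H (HM₁ H)) (c*[a*b]²≡c*a²*b² (suc m C suc j) (suc j) (m C j))
                       (HM₁-extremal H j≤m uniform)
      HM₂≤ , HM₂≡⇔ = subst (ExtremalBound H (HM₂ H)) (cong ((suc m C suc j) *_) ([a^k]²≡a^[2*k] (m C j) (suc j)))
                       (HM₂-extremal H j≤m uniform)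
  in HM₁≤ , HM₂≤ , HM₁≡⇔ , HM₂≡⇔
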